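{- Let $b,c$ be positive integers, $(a_1,a_2)$ a positive imaginary root, and $(p,q)$ positive integers with $q\le a_1$, $p\le a_2$ and $a_1p+a_2q<a_1a_2+a_1+a_2$. Let $(S_1,S_2)$ be the extremal pair of size $(q;p)$ in $\mathcal{D}^{a_1\times a_2}$. Then: (i) $(S_1,S_2)$ is compatible provided that for every $u\in S_1$ with left endpoint $E$ and every $v\in S_2$ with top endpoint $F$ at least one of $|(EF)_1|>b|(EF)_2\cap S_2|$ and $|(EF)_2|>c|(EF)_1\cap S_1|$ holds. (ii) For $1\le q'\le q$, $1\le p'\le p$, $u=u_{q'}$ and $v=v_{a_2-p'+1}$, the inequality $|(EF)_1|>b|(EF)_2\cap S_2|$ is equivalent to $(ba_2-a_1)(p'-1)-a_2(q'-1)>(bp-a_1)a_2$, and the inequality $|(EF)_2|>c|(EF)_1\cap S_1|$ is equivalent to $(ca_1-a_2)(q'-1)-a_1(p'-1)>(cq-a_2)a_1$. Consequently $(S_1,S_2)$ is compatible provided that for every $1\le p'\le p$, $1\le q'\le q$ at least one of these two numerical inequalities holds.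
   Context: A positive imaginary root is $(a_1,a_2)\in\mathbb{Z}_{>0}^2$ with $ca_1^2-bca_1a_2+ba_2^2\le0$. $\mathcal{D}=\mathcal{D}^{a_1\times a_2}$ is the maximal Dyck path from $(0,0)$ to $(a_1,a_2)$ (unit east/north steps, never above the diagonal segment, every lattice point strictly above it strictly above the diagonal), with horizontal edges $u_1,\dots,u_{a_1}$ left to right and vertical edges $v_1,\dots,v_{a_2}$ bottom to top. The extremal pair of size $(s_1;s_2)$ is $(\{u_1,\dots,u_{s_1}\},\{v_{a_2-s_2+1},\dots,v_{a_2}\})$. For lattice points $A,B$ on $\mathcal{D}$, $AB$ is the subpath from $A$ going northeast to $B$, continuing from $(0,0)$ after reaching $(a_1,a_2)$ (identified), $AA$ the full cycle; $(AB)_1,(AB)_2$ are its horizontal/vertical edges and $AB^\circ$ its lattice points other than the endpoints. $(S_1,S_2)$ is compatible if for every $u\in S_1$, $v\in S_2$, with $E$ the left endpoint of $u$ and $F$ the upper endpoint of $v$, there is a lattice point $A\in EF^\circ$ with $|(AF)_1|=b|(AF)_2\cap S_2|$ or $|(EA)_2|=c|(EA)_1\cap S_1|$. -}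

module Defs where

open import Data.Nat using (ℕ; zero; suc; _+_; _*_; _∸_; _≤_; _<_; _≤ᵇ_; _<ᵇ_; _%_)
open import Data.Bool using (Bool; true; false; if_then_else_; not; _∧_)
open import Data.List using (List; []; _∷_; replicate; concatMap; upTo)
open import Data.Product using (Σ; _×_; ∃-syntax)
open import Data.Sum using (_⊎_)
open import Relation.Binary.PropositionalEquality using (_≡_)
open import Data.Integer as ℤ using (ℤ; +_)

countFrom : (ℕ → Bool) → ℕ → ℕ → ℕ
countFrom f s zero    = 0
countFrom f s (suc L) = (if f s then 1 else 0) + countFrom f (suc s) L

-- t mod n  (with t mod 0 = t; only used with n = a₁ + a₂ > 0)
wrap : ℕ → ℕ → ℕ
wrap zero    t = t
wrap (suc n) t = t % suc n

nth : List Bool → ℕ → Bool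
nth []       _       = false
nth (x ∷ xs) zero    = x
nth (x ∷ xs) (suc n) = nth xs n

-- The maximal Dyck path D^{a₁×a₂}.
-- Its height at x-coordinate k (0 ≤ k ≤ a₁) is ⌊k a₂ / a₁⌋, computed as
-- #{ y ∈ [1,a₂] | y a₁ ≤ k a₂ }.
height : ℕ → ℕ → ℕ → ℕ
height a₁ a₂ k = countFrom (λ y → y * a₁ ≤ᵇ k * a₂) 1 a₂

-- steps of column k: the east step from (k,h_k) to (k+1,h_k), then the
-- north steps up to (k+1,h_{k+1});  true = east (horizontal), false = north
column : ℕ → ℕ → ℕ → List Bool
column a₁ a₂ k = true ∷ replicate (height a₁ a₂ (suc k) ∸ height a₁ a₂ k) false

dyckSteps : ℕ → ℕ → List Bool
dyckSteps a₁ a₂ = concatMap (column a₁ a₂) (upTo a₁)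

-- number of steps = number of lattice points on the (cyclic) path
len : ℕ → ℕ → ℕ
len a₁ a₂ = a₁ + a₂

-- Steps are indexed by t ∈ [0, a₁+a₂), cyclically (indices taken mod a₁+a₂).
-- Lattice point (vertex) k ∈ [0, a₁+a₂) is the starting point of step k;
-- vertex 0 = (0,0) = (a₁,a₂).
isE : ℕ → ℕ → ℕ → Bool
isE a₁ a₂ t = nth (dyckSteps a₁ a₂) (wrap (len a₁ a₂) t)

isN : ℕ → ℕ → ℕ → Bool
isN a₁ a₂ t = not (isE a₁ a₂ t)

-- if step t is horizontal, it is u_{hIdx t}; if vertical, it is v_{vIdx t}
hIdx : ℕ → ℕ → ℕ → ℕ
hIdx a₁ a₂ t = countFrom (isE a₁ a₂) 0 (suc (wrap (len a₁ a₂) t))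

vIdx : ℕ → ℕ → ℕ → ℕ
vIdx a₁ a₂ t = countFrom (isN a₁ a₂) 0 (suc (wrap (len a₁ a₂) t))

-- Number of steps of the subpath AB from vertex i to vertex j
-- (i, j < a₁+a₂); AA is the full cycle.
arcLen : ℕ → ℕ → ℕ → ℕ
arcLen N i j = if i <ᵇ j then j ∸ i else N ∸ (i ∸ j)

-- The extremal pair of size (q; p):
-- S₁ = {u₁,…,u_q},  S₂ = {v_{a₂-p+1},…,v_{a₂}}
extS₁ : ℕ → ℕ → ℕ → ℕ → Bool
extS₁ a₁ a₂ q t = isE a₁ a₂ t ∧ (hIdx a₁ a₂ t ≤ᵇ q)

extS₂ : ℕ → ℕ → ℕ → ℕ → Bool
extS₂ a₁ a₂ p t = isN a₁ a₂ t ∧ ((a₂ ∸ p) <ᵇ vIdx a₁ a₂ t)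

-- For the subpath starting at vertex s with L steps:
-- |(·)₁|, |(·)₂|, |(·)₁ ∩ S₁|, |(·)₂ ∩ S₂|
#H : ℕ → ℕ → ℕ → ℕ → ℕ
#H a₁ a₂ s L = countFrom (isE a₁ a₂) s L

#V : ℕ → ℕ → ℕ → ℕ → ℕ
#V a₁ a₂ s L = countFrom (isN a₁ a₂) s L

#H∩ : ℕ → ℕ → (ℕ → Bool) → ℕ → ℕ → ℕ
#H∩ a₁ a₂ S₁ s L = countFrom (λ t → isE a₁ a₂ t ∧ S₁ t) s L

#V∩ : ℕ → ℕ → (ℕ → Bool) → ℕ → ℕ → ℕ
#V∩ a₁ a₂ S₂ s L = countFrom (λ t → isN a₁ a₂ t ∧ S₂ t) s L

-- For u = step tu ∈ S₁ (left endpoint E = vertex tu) and v = step tv ∈ S₂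
-- (upper endpoint F = vertex tv+1 mod (a₁+a₂)), with L = |EF| there is
-- A = vertex E+m, 0 < m < L (A ∈ EF°) such that
-- |(AF)₁| = b|(AF)₂ ∩ S₂|  or  |(EA)₂| = c|(EA)₁ ∩ S₁|.
Compatible : (a₁ a₂ b c : ℕ) → (S₁ S₂ : ℕ → Bool) → Set
Compatible a₁ a₂ b c S₁ S₂ =
  ∀ tu tv → tu < len a₁ a₂ → tv < len a₁ a₂ →
  isE a₁ a₂ tu ≡ true → S₁ tu ≡ true →
  isN a₁ a₂ tv ≡ true → S₂ tv ≡ true →
  let E = tu
      F = wrap (len a₁ a₂) (suc tv)
      L = arcLen (len a₁ a₂) E F
  in ∃[ m ] (0 < m × m < L ×
       (#H a₁ a₂ (E + m) (L ∸ m) ≡ b * #V∩ a₁ a₂ S₂ (E + m) (L ∸ m)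
        ⊎ #V a₁ a₂ E m ≡ c * #H∩ a₁ a₂ S₁ E m))

Cond₁ : (a₁ a₂ b : ℕ) → (S₂ : ℕ → Bool) → ℕ → ℕ → Set
Cond₁ a₁ a₂ b S₂ tu tv =
  let F = wrap (len a₁ a₂) (suc tv)
      L = arcLen (len a₁ a₂) tu F
  in b * #V∩ a₁ a₂ S₂ tu L < #H a₁ a₂ tu L

Cond₂ : (a₁ a₂ c : ℕ) → (S₁ : ℕ → Bool) → ℕ → ℕ → Set
Cond₂ a₁ a₂ c S₁ tu tv =
  let F = wrap (len a₁ a₂) (suc tv)
      L = arcLen (len a₁ a₂) tu F
  in c * #H∩ a₁ a₂ S₁ tu L < #V a₁ a₂ tu L

Ineq₁ : (a₁ a₂ b p p' q' : ℕ) → Set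
Ineq₁ a₁ a₂ b p p' q' =
  (+ (b * p) ℤ.- + a₁) ℤ.* + a₂
    ℤ.< (+ (b * a₂) ℤ.- + a₁) ℤ.* + (p' ∸ 1) ℤ.- + a₂ ℤ.* + (q' ∸ 1)

Ineq₂ : (a₁ a₂ c q p' q' : ℕ) → Set
Ineq₂ a₁ a₂ c q p' q' =
  (+ (c * q) ℤ.- + a₂) ℤ.* + a₁
    ℤ.< (+ (c * a₁) ℤ.- + a₂) ℤ.* + (q' ∸ 1) ℤ.- + a₁ ℤ.* + (p' ∸ 1)

-- Proof idea.  (i) Fix u ∈ S₁ with left endpoint E and v ∈ S₂ with upper endpoint F.  As A moves
-- from E to F, |(AF)₁| − b|(AF)₂ ∩ S₂| decreases by at most one per step and ends at −b (only the
-- vertical edge v ∈ S₂ is left), while |(EA)₂| − c|(EA)₁ ∩ S₁| increases by at most one per step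
-- and starts at −c (after the horizontal edge u ∈ S₁).  The two strict inequalities say that the
-- first starts positive, resp. that the second ends positive, so by a discrete intermediate value
-- argument one of them vanishes at an interior point A, which is what compatibility asks for.
-- (ii) Above x = k the path has height h(k) = ⌊k a₂ / a₁⌋, and a₁p + a₂q < a₁a₂ + a₁ + a₂ gives
-- h(q − 1) ≤ a₂ − p: the edges of S₁ lie below those of S₂, so E precedes F and EF does not wrap
-- around.  The four counts along EF are then differences of coordinates of E and F, and through
-- h(k) < z ⇔ k a₂ < z a₁ each strict inequality becomes the stated linear one.
module Submission where

open import Defs
open import Data.Nat as ℕ using (ℕ; suc)
open import Relation.Binary.PropositionalEquality
open import Function.Bundles using (_⇔_; mk⇔; module Equivalence)
import Function.Properties.Equivalence as ⇔

module NaturalForms where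

  open import Data.Integer using (ℤ; +_; _+_; _*_; _-_; -_; _<_; +<+)
  open import Data.Integer.Properties using (+-monoˡ-<; pos-+; pos-*; drop‿+<+)
  open import Data.Integer.Tactic.RingSolver using (solve-∀)

  <-translate : ∀ {x y x′ y′ : ℤ} → x′ - x ≡ y′ - y → x < y → x′ < y′
  <-translate {x} {y} {x′} {y′} shift x<y =
    subst₂ _<_ (cancel x x′) (trans (cong (λ d → y + d) shift) (cancel y y′)) (+-monoˡ-< (x′ - x) x<y)
    where
      cancel : ∀ a b → a + (b - a) ≡ b
      cancel = solve-∀

  <-translate⇔ : ∀ {x y x′ y′ : ℤ} → x′ - x ≡ y′ - y → (x < y ⇔ x′ < y′)
  <-translate⇔ {x} {y} {x′} {y′} shift = mk⇔ (<-translate shift) (<-translate back)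
    where
      negate : ∀ a b → a - b ≡ - (b - a)
      negate = solve-∀
      back : x - x′ ≡ y - y′
      back = trans (negate x x′) (trans (cong -_ shift) (sym (negate y y′)))

  +<+⇔ : ∀ {m n} → (+ m < + n ⇔ m ℕ.< n)
  +<+⇔ = mk⇔ drop‿+<+ +<+

  ineq₁⇔ : ∀ {a₁ a₂ b p} u y P Q → a₂ ≡ y ℕ.+ P → p ≡ u ℕ.+ P →
    (Ineq₁ a₁ a₂ b p (suc P) (suc Q) ⇔ (b ℕ.* u ℕ.+ Q) ℕ.* a₂ ℕ.< y ℕ.* a₁)
  ineq₁⇔ {a₁} {_} {b} u y P Q refl refl = ⇔.trans (<-translate⇔ shift) +<+⇔
    where
      shift : + ((b ℕ.* u ℕ.+ Q) ℕ.* (y ℕ.+ P)) - (+ (b ℕ.* (u ℕ.+ P)) - + a₁) * + (y ℕ.+ P)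
            ≡ + (y ℕ.* a₁) - ((+ (b ℕ.* (y ℕ.+ P)) - + a₁) * + P - + (y ℕ.+ P) * + Q)
      shift = trans (cong₂ (λ X Z → X - Z) cast₁ (cong₂ (λ B Y → (B - + a₁) * Y) cast₂ cast₃))
             (trans (identity (+ a₁) (+ b) (+ u) (+ y) (+ P) (+ Q))
               (sym (cong₂ (λ X Z → X - Z) (pos-* y a₁) (cong₂ (λ B Y → (B - + a₁) * + P - Y * + Q) cast₄ cast₃))))
        where
          cast₁ : + ((b ℕ.* u ℕ.+ Q) ℕ.* (y ℕ.+ P)) ≡ (+ b * + u + + Q) * (+ y + + P)
          cast₁ = trans (pos-* (b ℕ.* u ℕ.+ Q) (y ℕ.+ P))
            (cong₂ _*_ (trans (pos-+ (b ℕ.* u) Q) (cong (λ X → X + + Q) (pos-* b u))) (pos-+ y P))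
          cast₂ : + (b ℕ.* (u ℕ.+ P)) ≡ + b * (+ u + + P)
          cast₂ = trans (pos-* b (u ℕ.+ P)) (cong (λ X → + b * X) (pos-+ u P))
          cast₃ : + (y ℕ.+ P) ≡ + y + + P
          cast₃ = pos-+ y P
          cast₄ : + (b ℕ.* (y ℕ.+ P)) ≡ + b * (+ y + + P)
          cast₄ = trans (pos-* b (y ℕ.+ P)) (cong (λ X → + b * X) (pos-+ y P))
          identity : ∀ A B U Y P Q → (B * U + Q) * (Y + P) - (B * (U + P) - A) * (Y + P)
                                   ≡ Y * A - ((B * (Y + P) - A) * P - (Y + P) * Q)
          identity = solve-∀

  ineq₂⇔ : ∀ {a₁ a₂ c q} t y P Q → a₂ ≡ y ℕ.+ P → q ≡ t ℕ.+ Q →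
    (Ineq₂ a₁ a₂ c q (suc P) (suc Q) ⇔ Q ℕ.* a₂ ℕ.+ c ℕ.* t ℕ.* a₁ ℕ.< y ℕ.* a₁)
  ineq₂⇔ {a₁} {_} {c} t y P Q refl refl = ⇔.trans (<-translate⇔ shift) +<+⇔
    where
      shift : + (Q ℕ.* (y ℕ.+ P) ℕ.+ c ℕ.* t ℕ.* a₁) - (+ (c ℕ.* (t ℕ.+ Q)) - + (y ℕ.+ P)) * + a₁
            ≡ + (y ℕ.* a₁) - ((+ (c ℕ.* a₁) - + (y ℕ.+ P)) * + Q - + a₁ * + P)
      shift = trans (cong₂ (λ X Z → X - Z) cast₁ (cong₂ (λ C Y → (C - Y) * + a₁) cast₂ cast₃))
             (trans (identity (+ a₁) (+ c) (+ t) (+ y) (+ P) (+ Q))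
               (sym (cong₂ (λ X Z → X - Z) (pos-* y a₁) (cong₂ (λ C Y → (C - Y) * + Q - + a₁ * + P) (pos-* c a₁) cast₃))))
        where
          cast₁ : + (Q ℕ.* (y ℕ.+ P) ℕ.+ c ℕ.* t ℕ.* a₁) ≡ + Q * (+ y + + P) + + c * + t * + a₁
          cast₁ = trans (pos-+ (Q ℕ.* (y ℕ.+ P)) (c ℕ.* t ℕ.* a₁))
            (cong₂ _+_ (trans (pos-* Q (y ℕ.+ P)) (cong (λ X → + Q * X) (pos-+ y P)))
                       (trans (pos-* (c ℕ.* t) a₁) (cong (λ X → X * + a₁) (pos-* c t))))
          cast₂ : + (c ℕ.* (t ℕ.+ Q)) ≡ + c * (+ t + + Q)
          cast₂ = trans (pos-* c (t ℕ.+ Q)) (cong (λ X → + c * X) (pos-+ t Q))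
          cast₃ : + (y ℕ.+ P) ≡ + y + + P
          cast₃ = pos-+ y P
          identity : ∀ A C T Y P Q → Q * (Y + P) + C * T * A - (C * (T + Q) - (Y + P)) * A
                                   ≡ Y * A - ((C * A - (Y + P)) * Q - A * P)
          identity = solve-∀

open NaturalForms
open import Level using (0ℓ)
open import Function using (_∘_; id)
open import Data.Nat
open import Data.Nat.Properties
open import Data.Nat.DivMod using (m≤n⇒m%n≡m; n%n≡0; [m+n]%n≡m%n)
import Data.Nat.Tactic.RingSolver as ℕ-Solver
open import Data.Bool using (Bool; true; false; if_then_else_; not; _∧_; T)
open import Data.Bool.Properties using (T-≡; ¬-not; not-injective; ∧-assoc; ∧-idem)
open import Data.Unit using (tt)
open import Data.List using (List; []; _∷_; _++_; length; replicate; applyUpTo; concatMap)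
open import Data.Product using (_×_; _,_; proj₁; proj₂; ∃-syntax)
open import Data.Sum as Sum using (_⊎_; inj₁; inj₂)
open import Data.Empty using (⊥-elim)
open import Relation.Nullary using (¬_; yes; no)
import Relation.Binary.Reasoning.Setoid as SetoidReasoning

module ⇔-Reasoning = SetoidReasoning (⇔.⇔-setoid 0ℓ)

indicator : Bool → ℕ
indicator x = if x then 1 else 0

indicator≤1 : ∀ x → indicator x ≤ 1
indicator≤1 true  = ≤-refl
indicator≤1 false = z≤n

countFrom-+ : ∀ f s m L → countFrom f s (m + L) ≡ countFrom f s m + countFrom f (s + m) L
countFrom-+ f s zero    L = cong (λ x → countFrom f x L) (sym (+-identityʳ s))
countFrom-+ f s (suc m) L = begin
    indicator (f s) + countFrom f (suc s) (m + L)
  ≡⟨ cong (indicator (f s) +_) (countFrom-+ f (suc s) m L) ⟩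
    indicator (f s) + (countFrom f (suc s) m + countFrom f (suc s + m) L)
  ≡⟨ sym (+-assoc (indicator (f s)) _ _) ⟩
    indicator (f s) + countFrom f (suc s) m + countFrom f (suc s + m) L
  ≡⟨ cong (λ x → indicator (f s) + countFrom f (suc s) m + countFrom f x L) (sym (+-suc s m)) ⟩
    indicator (f s) + countFrom f (suc s) m + countFrom f (s + suc m) L ∎
  where open ≡-Reasoning

countFrom-snoc : ∀ f s L → countFrom f s (suc L) ≡ countFrom f s L + indicator (f (s + L))
countFrom-snoc f s L = begin
  countFrom f s (suc L)                          ≡⟨ cong (countFrom f s) (+-comm 1 L) ⟩
  countFrom f s (L + 1)                          ≡⟨ countFrom-+ f s L 1 ⟩
  countFrom f s L + (indicator (f (s + L)) + 0)  ≡⟨ cong (countFrom f s L +_) (+-identityʳ _) ⟩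
  countFrom f s L + indicator (f (s + L))        ∎
  where open ≡-Reasoning

countFrom-shift : ∀ f s L → countFrom f (suc s) L ≡ countFrom (f ∘ suc) s L
countFrom-shift f s zero    = refl
countFrom-shift f s (suc L) = cong (indicator (f (suc s)) +_) (countFrom-shift f (suc s) L)

countFrom-suc-true : ∀ f s L → f (s + L) ≡ true → countFrom f s (suc L) ≡ suc (countFrom f s L)
countFrom-suc-true f s L fsL = trans (countFrom-snoc f s L) (trans (cong (λ x → countFrom f s L + indicator x) fsL) (+-comm _ 1))

countFrom-suc-false : ∀ f s L → f (s + L) ≡ false → countFrom f s (suc L) ≡ countFrom f s L
countFrom-suc-false f s L fsL = trans (countFrom-snoc f s L) (trans (cong (λ x → countFrom f s L + indicator x) fsL) (+-identityʳ _))

countFrom-window : ∀ f s L → countFrom f s L ≡ countFrom f 0 (s + L) ∸ countFrom f 0 s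
countFrom-window f s L =
  sym (trans (cong (_∸ countFrom f 0 s) (countFrom-+ f 0 s L)) (m+n∸m≡n (countFrom f 0 s) _))

countFrom-cong : ∀ {f g} s L → (∀ i → s ≤ i → i < s + L → f i ≡ g i) →
                 countFrom f s L ≡ countFrom g s L
countFrom-cong s zero    f≗g = refl
countFrom-cong s (suc L) f≗g = cong₂ _+_
  (cong indicator (f≗g s ≤-refl (m<m+n s z<s)))
  (countFrom-cong (suc s) L λ i s<i i<s+L →
    f≗g i (<⇒≤ s<i) (subst (i <_) (sym (+-suc s L)) i<s+L))

countFrom-≤ : ∀ f s L → countFrom f s L ≤ L
countFrom-≤ f s zero    = z≤n
countFrom-≤ f s (suc L) = +-mono-≤ (indicator≤1 (f s)) (countFrom-≤ f (suc s) L)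

countFrom-const : ∀ x s L → countFrom (λ _ → x) s L ≡ L * indicator x
countFrom-const x s zero    = refl
countFrom-const x s (suc L) = cong (indicator x +_) (countFrom-const x (suc s) L)

countFrom-all : ∀ f s L → (∀ i → s ≤ i → i < s + L → f i ≡ true) → countFrom f s L ≡ L
countFrom-all f s L all = begin
  countFrom f s L              ≡⟨ countFrom-cong s L all ⟩
  countFrom (λ _ → true) s L   ≡⟨ countFrom-const true s L ⟩
  L * 1                        ≡⟨ *-identityʳ L ⟩
  L                            ∎
  where open ≡-Reasoning

countFrom-none : ∀ f s L → (∀ i → s ≤ i → i < s + L → f i ≡ false) → countFrom f s L ≡ 0
countFrom-none f s L none = begin
  countFrom f s L              ≡⟨ countFrom-cong s L none ⟩
  countFrom (λ _ → false) s L  ≡⟨ countFrom-const false s L ⟩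
  L * 0                        ≡⟨ *-zeroʳ L ⟩
  0                            ∎
  where open ≡-Reasoning

countFrom-⊆ : ∀ {f g} s L → (∀ i → f i ≡ true → g i ≡ true) → countFrom f s L ≤ countFrom g s L
countFrom-⊆         s zero    f⊆g = z≤n
countFrom-⊆ {f} {g} s (suc L) f⊆g with f s in fs
... | true  rewrite f⊆g s fs = s≤s (countFrom-⊆ (suc s) L f⊆g)
... | false = ≤-trans (countFrom-⊆ (suc s) L f⊆g) (m≤n+m _ _)

countFrom-monoʳ : ∀ f s {L L′} → L ≤ L′ → countFrom f s L ≤ countFrom f s L′
countFrom-monoʳ f s {L} {L′} L≤L′ = begin
  countFrom f s L                                       ≤⟨ m≤m+n _ _ ⟩
  countFrom f s L + countFrom f (s + L) (L′ ∸ L)        ≡⟨ sym (countFrom-+ f s L (L′ ∸ L)) ⟩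
  countFrom f s (L + (L′ ∸ L))                          ≡⟨ cong (countFrom f s) (m+[n∸m]≡n L≤L′) ⟩
  countFrom f s L′                                      ∎
  where open ≤-Reasoning

countFrom-prefix-step : ∀ f s L → countFrom f s (suc L) ≤ suc (countFrom f s L)
countFrom-prefix-step f s L = begin
  countFrom f s (suc L)                            ≡⟨ countFrom-snoc f s L ⟩
  countFrom f s L + indicator (f (s + L))          ≤⟨ +-monoʳ-≤ (countFrom f s L) (indicator≤1 _) ⟩
  countFrom f s L + 1                              ≡⟨ +-comm _ 1 ⟩
  suc (countFrom f s L)                            ∎
  where open ≤-Reasoning

countFrom-suffix-mono : ∀ f s L m → countFrom f (s + suc m) (L ∸ suc m) ≤ countFrom f (s + m) (L ∸ m)
countFrom-suffix-mono f s L m rewrite +-suc s m | sym (pred[m∸n]≡m∸[1+n] L m) = drop (L ∸ m)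
  where
    drop : ∀ K → countFrom f (suc (s + m)) (pred K) ≤ countFrom f (s + m) K
    drop zero    = z≤n
    drop (suc K) = m≤n+m _ _

countFrom-suffix-step : ∀ f s L m → countFrom f (s + m) (L ∸ m) ≤ suc (countFrom f (s + suc m) (L ∸ suc m))
countFrom-suffix-step f s L m rewrite +-suc s m | sym (pred[m∸n]≡m∸[1+n] L m) = step (L ∸ m)
  where
    step : ∀ K → countFrom f (s + m) K ≤ suc (countFrom f (suc (s + m)) (pred K))
    step zero    = z≤n
    step (suc K) = +-monoˡ-≤ _ (indicator≤1 (f (s + m)))

≤ᵇ-true : ∀ {m n} → m ≤ n → (m ≤ᵇ n) ≡ true
≤ᵇ-true m≤n = Equivalence.to T-≡ (≤⇒≤ᵇ m≤n)

≤ᵇ-false : ∀ {m n} → ¬ m ≤ n → (m ≤ᵇ n) ≡ false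
≤ᵇ-false {m} {n} m≰n = ¬-not λ m≤ᵇn → m≰n (≤ᵇ⇒≤ m n (Equivalence.from T-≡ m≤ᵇn))

≤ᵇ-sound : ∀ {m n} → (m ≤ᵇ n) ≡ true → m ≤ n
≤ᵇ-sound {m} {n} m≤ᵇn = ≤ᵇ⇒≤ m n (Equivalence.from T-≡ m≤ᵇn)

countFrom-≥ : ∀ f s z L → z ≤ L → (∀ i → s ≤ i → i < s + z → f i ≡ true) → z ≤ countFrom f s L
countFrom-≥ f s z L z≤L all = begin
  z                   ≡⟨ sym (countFrom-all f s z all) ⟩
  countFrom f s z     ≤⟨ countFrom-monoʳ f s z≤L ⟩
  countFrom f s L     ∎
  where open ≤-Reasoning

countFrom-≤ₗ : ∀ f s z L → z ≤ L → (∀ i → s + z ≤ i → i < s + L → f i ≡ false) → countFrom f s L ≤ z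
countFrom-≤ₗ f s z L z≤L none = begin
  countFrom f s L                                         ≡⟨ cong (countFrom f s) (sym (m+[n∸m]≡n z≤L)) ⟩
  countFrom f s (z + (L ∸ z))                             ≡⟨ countFrom-+ f s z (L ∸ z) ⟩
  countFrom f s z + countFrom f (s + z) (L ∸ z)           ≡⟨ cong (countFrom f s z +_) (countFrom-none f (s + z) (L ∸ z) none′) ⟩
  countFrom f s z + 0                                     ≤⟨ +-monoˡ-≤ 0 (countFrom-≤ f s z) ⟩
  z + 0                                                   ≡⟨ +-identityʳ z ⟩
  z                                                       ∎
  where
    open ≤-Reasoning
    none′ : ∀ i → s + z ≤ i → i < s + z + (L ∸ z) → f i ≡ false
    none′ i s+z≤i i< = none i s+z≤i (subst (i <_) (trans (+-assoc s z (L ∸ z)) (cong (s +_) (m+[n∸m]≡n z≤L))) i<)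

⊓-indicator-step : ∀ q x m → m ⊓ q + indicator (x ∧ (m + indicator x ≤ᵇ q)) ≡ (m + indicator x) ⊓ q
⊓-indicator-step q false m = trans (+-identityʳ _) (cong (_⊓ q) (sym (+-identityʳ m)))
⊓-indicator-step q true  m rewrite +-comm m 1 with suc m ≤? q
... | yes m<q rewrite ≤ᵇ-true m<q | m≤n⇒m⊓n≡m m<q | m≤n⇒m⊓n≡m (<⇒≤ m<q) = +-comm m 1
... | no  m≮q rewrite ≤ᵇ-false m≮q | m≥n⇒m⊓n≡n (≤-pred (≰⇒> m≮q))
                    | m≥n⇒m⊓n≡n (≤-trans (≤-pred (≰⇒> m≮q)) (n≤1+n m)) = +-identityʳ q

∸-indicator-step : ∀ r x m → (m ∸ r) + indicator (x ∧ (r <ᵇ m + indicator x)) ≡ (m + indicator x) ∸ r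
∸-indicator-step r false m = trans (+-identityʳ _) (cong (_∸ r) (sym (+-identityʳ m)))
∸-indicator-step r true  m rewrite +-comm m 1 with r ≤? m
... | yes r≤m rewrite Equivalence.to T-≡ (<⇒<ᵇ (s≤s r≤m)) = trans (+-comm _ 1) (sym (+-∸-assoc 1 r≤m))
... | no  r≰m rewrite ≤ᵇ-false {suc r} {suc m} (λ r<1+m → r≰m (≤-pred r<1+m))
                    | m≤n⇒m∸n≡0 (<⇒≤ (≰⇒> r≰m)) | m≤n⇒m∸n≡0 (≰⇒> r≰m) = refl

countFrom-first : ∀ f q T → countFrom (λ t → f t ∧ (countFrom f 0 (suc t) ≤ᵇ q)) 0 T ≡ countFrom f 0 T ⊓ q
countFrom-first f q zero    = refl
countFrom-first f q (suc T) = begin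
    countFrom g 0 (suc T)
  ≡⟨ countFrom-snoc g 0 T ⟩
    countFrom g 0 T + indicator (g T)
  ≡⟨ cong₂ _+_ (countFrom-first f q T) (cong (λ n → indicator (f T ∧ (n ≤ᵇ q))) (countFrom-snoc f 0 T)) ⟩
    countFrom f 0 T ⊓ q + indicator (f T ∧ (countFrom f 0 T + indicator (f T) ≤ᵇ q))
  ≡⟨ ⊓-indicator-step q (f T) (countFrom f 0 T) ⟩
    (countFrom f 0 T + indicator (f T)) ⊓ q
  ≡⟨ cong (_⊓ q) (sym (countFrom-snoc f 0 T)) ⟩
    countFrom f 0 (suc T) ⊓ q
  ∎
  where
    open ≡-Reasoning
    g = λ t → f t ∧ (countFrom f 0 (suc t) ≤ᵇ q)

countFrom-after : ∀ f r T → countFrom (λ t → f t ∧ (r <ᵇ countFrom f 0 (suc t))) 0 T ≡ countFrom f 0 T ∸ r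
countFrom-after f r zero    = sym (0∸n≡0 r)
countFrom-after f r (suc T) = begin
    countFrom g 0 (suc T)
  ≡⟨ countFrom-snoc g 0 T ⟩
    countFrom g 0 T + indicator (g T)
  ≡⟨ cong₂ _+_ (countFrom-after f r T) (cong (λ n → indicator (f T ∧ (r <ᵇ n))) (countFrom-snoc f 0 T)) ⟩
    (countFrom f 0 T ∸ r) + indicator (f T ∧ (r <ᵇ countFrom f 0 T + indicator (f T)))
  ≡⟨ ∸-indicator-step r (f T) (countFrom f 0 T) ⟩
    (countFrom f 0 T + indicator (f T)) ∸ r
  ≡⟨ cong (_∸ r) (sym (countFrom-snoc f 0 T)) ⟩
    countFrom f 0 (suc T) ∸ r
  ∎
  where
    open ≡-Reasoning
    g = λ t → f t ∧ (r <ᵇ countFrom f 0 (suc t))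

discrete-ivt : (P Q : ℕ → ℕ) → (∀ m → P (suc m) + Q m ≤ suc (P m + Q (suc m))) →
               ∀ n → P 0 < Q 0 → Q n < P n → ∃[ m ] (0 < m × m < n × P m ≡ Q m)
discrete-ivt P Q step zero P₀<Q₀ Q₀<P₀ = ⊥-elim (<-asym P₀<Q₀ Q₀<P₀)
discrete-ivt P Q step (suc n) P₀<Q₀ Qₙ<Pₙ with P 1 <? Q 1
... | yes P₁<Q₁ with discrete-ivt (P ∘ suc) (Q ∘ suc) (step ∘ suc) n P₁<Q₁ Qₙ<Pₙ
...   | m , 0<m , m<n , Pm≡Qm = suc m , z<s , s<s m<n , Pm≡Qm
discrete-ivt P Q step (suc n) P₀<Q₀ Qₙ<Pₙ | no P₁≮Q₁ = 1 , z<s , 1<1+n n Qₙ<Pₙ , P₁≡Q₁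
  where
    P₁≤Q₁ : P 1 ≤ Q 1
    P₁≤Q₁ = +-cancelʳ-≤ (suc (P 0)) (P 1) (Q 1) (begin
      P 1 + suc (P 0)    ≤⟨ +-monoʳ-≤ (P 1) P₀<Q₀ ⟩
      P 1 + Q 0          ≤⟨ step 0 ⟩
      suc (P 0 + Q 1)    ≡⟨ cong suc (+-comm (P 0) (Q 1)) ⟩
      suc (Q 1 + P 0)    ≡⟨ sym (+-suc (Q 1) (P 0)) ⟩
      Q 1 + suc (P 0)    ∎)
      where open ≤-Reasoning
    P₁≡Q₁ : P 1 ≡ Q 1
    P₁≡Q₁ = ≤-antisym P₁≤Q₁ (≮⇒≥ P₁≮Q₁)
    1<1+n : ∀ n → Q (suc n) < P (suc n) → 1 < suc n
    1<1+n zero    Q₁<P₁ = ⊥-elim (<⇒≱ Q₁<P₁ P₁≤Q₁)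
    1<1+n (suc n) _     = s<s z<s

suffix-balance : ∀ (h v : ℕ → Bool) b s n → 1 ≤ b → h (s + n) ≡ false → v (s + n) ≡ true →
  b * countFrom v s (suc n) < countFrom h s (suc n) →
  ∃[ m ] (0 < m × m < suc n × countFrom h (s + m) (suc n ∸ m) ≡ b * countFrom v (s + m) (suc n ∸ m))
suffix-balance h v b s n 1≤b hₙ vₙ h-wins
  with discrete-ivt P Q step n P₀<Q₀ Qₙ<Pₙ
  where
    P Q : ℕ → ℕ
    P m = b * countFrom v (s + m) (suc n ∸ m)
    Q m = countFrom h (s + m) (suc n ∸ m)
    step : ∀ m → P (suc m) + Q m ≤ suc (P m + Q (suc m))
    step m = begin
      P (suc m) + Q m          ≤⟨ +-mono-≤ (*-monoʳ-≤ b (countFrom-suffix-mono v s (suc n) m))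
                                           (countFrom-suffix-step h s (suc n) m) ⟩
      P m + suc (Q (suc m))    ≡⟨ +-suc (P m) _ ⟩
      suc (P m + Q (suc m))    ∎
      where open ≤-Reasoning
    P₀<Q₀ : P 0 < Q 0
    P₀<Q₀ rewrite +-identityʳ s = h-wins
    Qₙ<Pₙ : Q n < P n
    Qₙ<Pₙ rewrite m+n∸n≡m 1 n | hₙ | vₙ | *-identityʳ b = 1≤b
... | m , 0<m , m<n , Pm≡Qm = m , 0<m , m<n⇒m<1+n m<n , sym Pm≡Qm

prefix-balance : ∀ (h v : ℕ → Bool) c s n → 1 ≤ c → h s ≡ true → v s ≡ false →
  c * countFrom h s (suc n) < countFrom v s (suc n) →
  ∃[ m ] (0 < m × m < suc n × countFrom v s m ≡ c * countFrom h s m)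
prefix-balance h v c s n 1≤c hₛ vₛ v-wins
  with discrete-ivt P Q step n P₀<Q₀ v-wins
  where
    P Q : ℕ → ℕ
    P k = countFrom v s (suc k)
    Q k = c * countFrom h s (suc k)
    step : ∀ k → P (suc k) + Q k ≤ suc (P k + Q (suc k))
    step k = +-mono-≤ (countFrom-prefix-step v s (suc k)) (*-monoʳ-≤ c (countFrom-monoʳ h s (n≤1+n (suc k))))
    P₀<Q₀ : P 0 < Q 0
    P₀<Q₀ rewrite hₛ | vₛ | *-identityʳ c = 1≤c
... | k , _ , k<n , Pk≡Qk = suc k , z<s , s<s k<n , Pk≡Qk

arcLen-< : ∀ N {i j} → i < j → arcLen N i j ≡ j ∸ i
arcLen-< N {i} {j} i<j with i <ᵇ j in i<ᵇj
... | true  = refl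
... | false = ⊥-elim (subst T i<ᵇj (<⇒<ᵇ i<j))

arcLen-≥ : ∀ N {i j} → j ≤ i → arcLen N i j ≡ N ∸ (i ∸ j)
arcLen-≥ N {i} {j} j≤i with i <ᵇ j in i<ᵇj
... | true  = ⊥-elim (≤⇒≯ j≤i (<ᵇ⇒< i j (subst T (sym i<ᵇj) tt)))
... | false = refl

arcLen-forward : ∀ K tu tv → tu ≤ tv → tv < suc K → arcLen (suc K) tu (wrap (suc K) (suc tv)) ≡ suc (tv ∸ tu)
arcLen-forward K tu tv tu≤tv tv≤K with tv <? K
... | yes tv<K rewrite m≤n⇒m%n≡m tv<K = trans (arcLen-< (suc K) (s≤s tu≤tv)) (+-∸-assoc 1 tu≤tv)
... | no  tv≮K = begin
  arcLen (suc K) tu (suc tv % suc K)  ≡⟨ cong (λ x → arcLen (suc K) tu (suc x % suc K)) tv≡K ⟩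
  arcLen (suc K) tu (suc K % suc K)   ≡⟨ cong (arcLen (suc K) tu) (n%n≡0 (suc K)) ⟩
  arcLen (suc K) tu 0                 ≡⟨ arcLen-≥ (suc K) {tu} z≤n ⟩
  suc K ∸ tu                          ≡⟨ cong (λ x → suc x ∸ tu) (sym tv≡K) ⟩
  suc tv ∸ tu                         ≡⟨ +-∸-assoc 1 tu≤tv ⟩
  suc (tv ∸ tu)                       ∎
  where
    open ≡-Reasoning
    tv≡K : tv ≡ K
    tv≡K = ≤-antisym (≤-pred tv≤K) (≮⇒≥ tv≮K)

arc-to-step : ∀ K tu tv → tu < suc K → tv < suc K →
  ∃[ n ] (arcLen (suc K) tu (wrap (suc K) (suc tv)) ≡ suc n × wrap (suc K) (tu + n) ≡ tv)
arc-to-step K tu tv tu≤K tv≤K with tu ≤? tv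
... | yes tu≤tv = tv ∸ tu , arcLen-forward K tu tv tu≤tv tv≤K , wrap-tu+n
  where
    wrap-tu+n : (tu + (tv ∸ tu)) % suc K ≡ tv
    wrap-tu+n rewrite m+[n∸m]≡n tu≤tv = m≤n⇒m%n≡m (≤-pred tv≤K)
... | no tu≰tv = K ∸ d , arc , wrap-tu+n
  where
    d = tu ∸ suc tv
    tu≡ : tu ≡ suc tv + d
    tu≡ = sym (m+[n∸m]≡n (≰⇒> tu≰tv))
    d≤K : d ≤ K
    d≤K = ≤-trans (m∸n≤m tu (suc tv)) (≤-pred tu≤K)
    arc : arcLen (suc K) tu (suc tv % suc K) ≡ suc (K ∸ d)
    arc rewrite m≤n⇒m%n≡m (<-≤-trans (≰⇒> tu≰tv) (≤-pred tu≤K)) =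
      trans (arcLen-≥ (suc K) (≰⇒> tu≰tv)) (+-∸-assoc 1 d≤K)
    wrap-tu+n : (tu + (K ∸ d)) % suc K ≡ tv
    wrap-tu+n = begin
      (tu + (K ∸ d)) % suc K            ≡⟨ cong (λ x → (x + (K ∸ d)) % suc K) tu≡ ⟩
      (suc tv + d + (K ∸ d)) % suc K    ≡⟨ cong (_% suc K) (+-assoc (suc tv) d (K ∸ d)) ⟩
      (suc tv + (d + (K ∸ d))) % suc K  ≡⟨ cong (λ x → (suc tv + x) % suc K) (m+[n∸m]≡n d≤K) ⟩
      (suc tv + K) % suc K              ≡⟨ cong (_% suc K) (sym (+-suc tv K)) ⟩
      (tv + suc K) % suc K              ≡⟨ [m+n]%n≡m%n tv (suc K) ⟩
      tv % suc K                        ≡⟨ m≤n⇒m%n≡m (≤-pred tv≤K) ⟩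
      tv                                ∎
      where open ≡-Reasoning

-- The arc length L is left abstract so that Cond₁ and Cond₂, which mention
-- L = arcLen …, apply to it without rewriting.
balanced-vertex : ∀ a₁ a₂ b c S₁ S₂ tu n → 1 ≤ b → 1 ≤ c →
  isE a₁ a₂ tu ≡ true → S₁ tu ≡ true → isN a₁ a₂ (tu + n) ≡ true → S₂ (tu + n) ≡ true →
  ∀ L → L ≡ suc n →
  b * #V∩ a₁ a₂ S₂ tu L < #H a₁ a₂ tu L ⊎ c * #H∩ a₁ a₂ S₁ tu L < #V a₁ a₂ tu L →
  ∃[ m ] (0 < m × m < L ×
    (#H a₁ a₂ (tu + m) (L ∸ m) ≡ b * #V∩ a₁ a₂ S₂ (tu + m) (L ∸ m)
     ⊎ #V a₁ a₂ tu m ≡ c * #H∩ a₁ a₂ S₁ tu m))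
balanced-vertex a₁ a₂ b c S₁ S₂ tu n 1≤b 1≤c uE uS₁ vN vS₂ .(suc n) refl (inj₁ cond₁)
  with suffix-balance (isE a₁ a₂) (λ t → isN a₁ a₂ t ∧ S₂ t) b tu n 1≤b
         (not-injective {y = false} vN) (cong₂ _∧_ vN vS₂) cond₁
... | m , 0<m , m<L , balanced = m , 0<m , m<L , inj₁ balanced
balanced-vertex a₁ a₂ b c S₁ S₂ tu n 1≤b 1≤c uE uS₁ vN vS₂ .(suc n) refl (inj₂ cond₂)
  with prefix-balance (λ t → isE a₁ a₂ t ∧ S₁ t) (isN a₁ a₂) c tu n 1≤c
         (cong₂ _∧_ uE uS₁) (cong not uE) cond₂
... | m , 0<m , m<L , balanced = m , 0<m , m<L , inj₂ balanced

WrapInvariant : ℕ → (ℕ → Bool) → Set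
WrapInvariant N S = ∀ t t′ → wrap N t ≡ wrap N t′ → S t ≡ S t′

isN-wrapInvariant : ∀ a₁ a₂ → WrapInvariant (len a₁ a₂) (isN a₁ a₂)
isN-wrapInvariant a₁ a₂ _ _ = cong (λ w → not (nth (dyckSteps a₁ a₂) w))

compatible-if-strict : ∀ a₁′ a₂ b c S₁ S₂ → 1 ≤ b → 1 ≤ c → WrapInvariant (len (suc a₁′) a₂) S₂ →
  (∀ tu tv → tu < len (suc a₁′) a₂ → tv < len (suc a₁′) a₂ →
     isE (suc a₁′) a₂ tu ≡ true → S₁ tu ≡ true → isN (suc a₁′) a₂ tv ≡ true → S₂ tv ≡ true →
     Cond₁ (suc a₁′) a₂ b S₂ tu tv ⊎ Cond₂ (suc a₁′) a₂ c S₁ tu tv) →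
  Compatible (suc a₁′) a₂ b c S₁ S₂
compatible-if-strict a₁′ a₂ b c S₁ S₂ 1≤b 1≤c S₂-inv strict tu tv tu<N tv<N uE uS₁ vN vS₂
  with arc-to-step (a₁′ + a₂) tu tv tu<N tv<N
... | n , L≡1+n , tu+n↦tv =
  balanced-vertex (suc a₁′) a₂ b c S₁ S₂ tu n 1≤b 1≤c uE uS₁
    (trans (isN-wrapInvariant (suc a₁′) a₂ (tu + n) tv same-step) vN)
    (trans (S₂-inv (tu + n) tv same-step) vS₂)
    _ L≡1+n (strict tu tv tu<N tv<N uE uS₁ vN vS₂)
  where
    same-step : wrap (len (suc a₁′) a₂) (tu + n) ≡ wrap (len (suc a₁′) a₂) tv
    same-step = trans tu+n↦tv (sym (m≤n⇒m%n≡m (≤-pred tv<N)))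

<∸⇔+< : ∀ m n o → (m < n ∸ o ⇔ m + o < n)
<∸⇔+< m n o = mk⇔ to from
  where
    to : m < n ∸ o → m + o < n
    to m<n∸o = subst (m + o <_) (m∸n+n≡m o≤n) (+-monoˡ-< o m<n∸o)
      where
        o≤n : o ≤ n
        o≤n = ≮⇒≥ λ n<o → n≮0 (subst (m <_) (m≤n⇒m∸n≡0 (<⇒≤ n<o)) m<n∸o)
    from : m + o < n → m < n ∸ o
    from m+o<n = subst (_< n ∸ o) (m+n∸n≡m m o) (∸-monoˡ-< m+o<n (m≤n+m o m))

extremal-bound : ∀ a₁ p r q → a₁ * p + (p + r) * suc q < a₁ * (p + r) + a₁ + (p + r) →
                 q * (p + r) < suc r * a₁
extremal-bound a₁ p r q hyp =
  +-cancelˡ-< (a₁ * p + (p + r)) _ _ (subst₂ _<_ (split-lhs a₁ p r q) (split-rhs a₁ p r q) hyp)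
  where
    split-lhs : ∀ a₁ p r q → a₁ * p + (p + r) * suc q ≡ a₁ * p + (p + r) + q * (p + r)
    split-lhs = ℕ-Solver.solve-∀
    split-rhs : ∀ a₁ p r q → a₁ * (p + r) + a₁ + (p + r) ≡ a₁ * p + (p + r) + suc r * a₁
    split-rhs = ℕ-Solver.solve-∀

module Staircase (h : ℕ → ℕ) where

  Walk : ℕ → ℕ → List Bool → ℕ → ℕ → Set
  Walk j v []           j′ v′ = j ≡ j′ × v ≡ v′
  Walk j v (true ∷ xs)  j′ v′ = v ≡ h j × Walk (suc j) v xs j′ v′
  Walk j v (false ∷ xs) j′ v′ = v < h j × Walk j (suc v) xs j′ v′

  walk-++ : ∀ {j v j₁ v₁ j₂ v₂} xs {ys} → Walk j v xs j₁ v₁ → Walk j₁ v₁ ys j₂ v₂ → Walk j v (xs ++ ys) j₂ v₂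
  walk-++ []           (refl , refl) w₂ = w₂
  walk-++ (true ∷ xs)  (e , w₁)      w₂ = e , walk-++ xs w₁ w₂
  walk-++ (false ∷ xs) (e , w₁)      w₂ = e , walk-++ xs w₁ w₂

  walk-north : ∀ j v d → v + d ≤ h j → Walk j v (replicate d false) j (v + d)
  walk-north j v zero    _       = refl , sym (+-identityʳ v)
  walk-north j v (suc d) v+d<h rewrite +-suc v d =
    ≤-trans (s≤s (m≤m+n v d)) v+d<h , walk-north j (suc v) d v+d<h

  walk-length : ∀ {j v j′ v′} xs → Walk j v xs j′ v′ → j + v + length xs ≡ j′ + v′
  walk-length {j} {v} []           (refl , refl) = +-identityʳ (j + v)
  walk-length {j} {v} (true ∷ xs)  (_ , w) = trans (+-suc (j + v) (length xs)) (walk-length xs w)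
  walk-length {j} {v} (false ∷ xs) (_ , w) =
    trans (+-suc (j + v) (length xs)) (trans (cong (_+ length xs) (sym (+-suc j v))) (walk-length xs w))

  walk-position : ∀ {j v j′ v′} xs → Walk j v xs j′ v′ → ∀ t → t < length xs →
    (nth xs t ≡ true  → v + countFrom (not ∘ nth xs) 0 t ≡ h (j + countFrom (nth xs) 0 t)) ×
    (nth xs t ≡ false → v + countFrom (not ∘ nth xs) 0 t < h (j + countFrom (nth xs) 0 t))
  walk-position {j} {v} (true ∷ xs) (e , w) zero _ =
    (λ _ → trans (+-identityʳ v) (trans e (cong h (sym (+-identityʳ j))))) , λ ()
  walk-position {j} {v} (false ∷ xs) (e , w) zero _ =
    (λ ()) , λ _ → subst₂ _<_ (sym (+-identityʳ v)) (cong h (sym (+-identityʳ j))) e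
  walk-position {j} {v} (true ∷ xs) (e , w) (suc t) (s≤s t<)
    rewrite countFrom-shift (not ∘ nth (true ∷ xs)) 0 t | countFrom-shift (nth (true ∷ xs)) 0 t
          | +-suc j (countFrom (nth xs) 0 t) = walk-position xs w t t<
  walk-position {j} {v} (false ∷ xs) (e , w) (suc t) (s≤s t<)
    rewrite countFrom-shift (not ∘ nth (false ∷ xs)) 0 t | countFrom-shift (nth (false ∷ xs)) 0 t
          | +-suc v (countFrom (not ∘ nth xs) 0 t) = walk-position xs w t t<

module DyckPath (a₁′ a₂ : ℕ) where

  a₁ N : ℕ
  a₁ = suc a₁′
  N  = len a₁ a₂

  h : ℕ → ℕ
  h = height a₁ a₂

  open Staircase h

  height-mono : ∀ {k k′} → k ≤ k′ → h k ≤ h k′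
  height-mono {k} {k′} k≤k′ = countFrom-⊆ 1 a₂ λ y y≤k →
    ≤ᵇ-true (≤-trans (≤ᵇ-sound {y * a₁} {k * a₂} y≤k) (*-monoˡ-≤ a₂ k≤k′))

  height-zero : h 0 ≡ 0
  height-zero = countFrom-none _ 1 a₂ λ { (suc i) _ _ → refl }

  height-a₁ : h a₁ ≡ a₂
  height-a₁ = countFrom-all _ 1 a₂ λ i _ i≤a₂ →
    ≤ᵇ-true (subst (i * a₁ ≤_) (*-comm a₂ a₁) (*-monoˡ-≤ a₁ (≤-pred i≤a₂)))

  height-≤ : ∀ k → h k ≤ a₂
  height-≤ k = countFrom-≤ _ 1 a₂

  height-<⇔ : ∀ k z → z ≤ a₂ → (h k < z ⇔ k * a₂ < z * a₁)
  height-<⇔ k zero     _    = mk⇔ (λ ()) (λ ())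
  height-<⇔ k (suc z) z<a₂ = mk⇔ to from
    where
      to : h k < suc z → k * a₂ < suc z * a₁
      to hk≤z with k * a₂ <? suc z * a₁
      ... | yes lt = lt
      ... | no ≮  = ⊥-elim (<⇒≱ hk≤z (countFrom-≥ _ 1 (suc z) a₂ z<a₂ λ i _ i≤z →
                      ≤ᵇ-true (≤-trans (*-monoˡ-≤ a₁ (≤-pred i≤z)) (≮⇒≥ ≮))))
      from : k * a₂ < suc z * a₁ → h k < suc z
      from lt = s≤s (countFrom-≤ₗ _ 1 z a₂ (<⇒≤ z<a₂) λ i z<i _ →
                  ≤ᵇ-false λ ia₁≤ka₂ → <⇒≱ lt (≤-trans (*-monoˡ-≤ a₁ z<i) ia₁≤ka₂))

  column-< : ∀ K y m → h (K ∸ 1) < y → y ≤ h K → (m < K ⇔ h m < y)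
  column-< zero    y m hK<y y≤hK = mk⇔ (λ ()) λ _ → ⊥-elim (<⇒≱ hK<y y≤hK)
  column-< (suc K) y m hK<y y≤hK = mk⇔
    (λ m<K → ≤-<-trans (height-mono (≤-pred m<K)) hK<y)
    (λ hm<y → ≰⇒> λ K≤m → <⇒≱ hm<y (≤-trans y≤hK (height-mono K≤m)))

  columns : ℕ → ℕ → List Bool
  columns j zero    = []
  columns j (suc n) = column a₁ a₂ j ++ columns (suc j) n

  concatMap-columns : ∀ f n j → (∀ i → f i ≡ j + i) → concatMap (column a₁ a₂) (applyUpTo f n) ≡ columns j n
  concatMap-columns f zero    j f≗j+ = refl
  concatMap-columns f (suc n) j f≗j+ = cong₂ _++_
    (cong (column a₁ a₂) (trans (f≗j+ 0) (+-identityʳ j)))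
    (concatMap-columns (f ∘ suc) n (suc j) λ i → trans (f≗j+ (suc i)) (+-suc j i))

  walk-column : ∀ j → Walk j (h j) (column a₁ a₂ j) (suc j) (h (suc j))
  walk-column j = refl , subst (Walk (suc j) (h j) (replicate (h (suc j) ∸ h j) false) (suc j)) rise
    (walk-north (suc j) (h j) (h (suc j) ∸ h j) (≤-reflexive rise))
    where
      rise : h j + (h (suc j) ∸ h j) ≡ h (suc j)
      rise = m+[n∸m]≡n (height-mono (n≤1+n j))

  walk-columns : ∀ j n → Walk j (h j) (columns j n) (j + n) (h (j + n))
  walk-columns j zero    = sym (+-identityʳ j) , cong h (sym (+-identityʳ j))
  walk-columns j (suc n) = walk-++ (column a₁ a₂ j) (walk-column j)
    (subst (λ x → Walk (suc j) (h (suc j)) (columns (suc j) n) x (h x)) (sym (+-suc j n)) (walk-columns (suc j) n))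

  D : List Bool
  D = dyckSteps a₁ a₂

  dyck-walk : Walk 0 0 D a₁ a₂
  dyck-walk = subst (λ xs → Walk 0 0 xs a₁ a₂) (sym (concatMap-columns id a₁ 0 λ _ → refl)) (
    subst₂ (λ v₀ v₁ → Walk 0 v₀ (columns 0 a₁) a₁ v₁) height-zero height-a₁ (walk-columns 0 a₁))

  wrap-< : ∀ {t} → t < N → wrap N t ≡ t
  wrap-< t<N = m≤n⇒m%n≡m (≤-pred t<N)

  xcoord ycoord : ℕ → ℕ
  xcoord = #H a₁ a₂ 0
  ycoord = #V a₁ a₂ 0

  private
    on-path : ∀ {f} t → t ≤ N → countFrom (f ∘ nth D ∘ wrap N) 0 t ≡ countFrom (f ∘ nth D) 0 t
    on-path {f} t t≤N = countFrom-cong 0 t λ i _ i<t → cong (f ∘ nth D) (wrap-< (<-≤-trans i<t t≤N))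

    position : ∀ t → t < N →
      (isE a₁ a₂ t ≡ true → ycoord t ≡ h (xcoord t)) × (isE a₁ a₂ t ≡ false → ycoord t < h (xcoord t))
    position t t<N
      rewrite on-path {not} t (<⇒≤ t<N) | on-path {id} t (<⇒≤ t<N) | wrap-< t<N =
      walk-position D dyck-walk t (subst (t <_) (sym (walk-length D dyck-walk)) t<N)

  east-on-height : ∀ t → t < N → isE a₁ a₂ t ≡ true → ycoord t ≡ h (xcoord t)
  east-on-height t t<N = proj₁ (position t t<N)

  north-below-height : ∀ t → t < N → isE a₁ a₂ t ≡ false → ycoord t < h (xcoord t)
  north-below-height t t<N = proj₂ (position t t<N)

  height-before-≤ : ∀ t → t ≤ N → h (xcoord t ∸ 1) ≤ ycoord t
  height-before-≤ zero    _     = ≤-reflexive height-zero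
  height-before-≤ (suc t) t<N with isE a₁ a₂ t in e
  ... | true  = begin
    h (xcoord (suc t) ∸ 1)  ≡⟨ cong (λ x → h (x ∸ 1)) (countFrom-suc-true (isE a₁ a₂) 0 t e) ⟩
    h (xcoord t)            ≡⟨ sym (east-on-height t t<N e) ⟩
    ycoord t                ≤⟨ countFrom-monoʳ (isN a₁ a₂) 0 (n≤1+n t) ⟩
    ycoord (suc t)          ∎
    where open ≤-Reasoning
  ... | false = begin
    h (xcoord (suc t) ∸ 1)  ≡⟨ cong (λ x → h (x ∸ 1)) (countFrom-suc-false (isE a₁ a₂) 0 t e) ⟩
    h (xcoord t ∸ 1)        ≤⟨ height-before-≤ t (<⇒≤ t<N) ⟩
    ycoord t                ≤⟨ countFrom-monoʳ (isN a₁ a₂) 0 (n≤1+n t) ⟩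
    ycoord (suc t)          ∎
    where open ≤-Reasoning

  hIdx-east : ∀ t → t < N → isE a₁ a₂ t ≡ true → hIdx a₁ a₂ t ≡ suc (xcoord t)
  hIdx-east t t<N east =
    trans (cong (countFrom (isE a₁ a₂) 0 ∘ suc) (wrap-< t<N)) (countFrom-suc-true (isE a₁ a₂) 0 t east)

  vIdx-north : ∀ t → t < N → isN a₁ a₂ t ≡ true → vIdx a₁ a₂ t ≡ suc (ycoord t)
  vIdx-north t t<N north =
    trans (cong (countFrom (isN a₁ a₂) 0 ∘ suc) (wrap-< t<N)) (countFrom-suc-true (isN a₁ a₂) 0 t north)

  module Extremal (p q : ℕ) where

    S₁ S₂ : ℕ → Bool
    S₁ = extS₁ a₁ a₂ q
    S₂ = extS₂ a₁ a₂ p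

    S₂-wrapInvariant : WrapInvariant N S₂
    S₂-wrapInvariant _ _ = cong λ w → not (nth D w) ∧ ((a₂ ∸ p) <ᵇ countFrom (isN a₁ a₂) 0 (suc w))

    private
      S₁-step : ∀ t → t < N → isE a₁ a₂ t ∧ S₁ t ≡ isE a₁ a₂ t ∧ (xcoord (suc t) ≤ᵇ q)
      S₁-step t t<N = trans (sym (∧-assoc (isE a₁ a₂ t) _ _))
        (cong₂ _∧_ (∧-idem _) (cong (λ w → countFrom (isE a₁ a₂) 0 (suc w) ≤ᵇ q) (wrap-< t<N)))

      S₂-step : ∀ t → t < N → isN a₁ a₂ t ∧ S₂ t ≡ isN a₁ a₂ t ∧ ((a₂ ∸ p) <ᵇ ycoord (suc t))
      S₂-step t t<N = trans (sym (∧-assoc (isN a₁ a₂ t) _ _))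
        (cong₂ _∧_ (∧-idem _) (cong (λ w → (a₂ ∸ p) <ᵇ countFrom (isN a₁ a₂) 0 (suc w)) (wrap-< t<N)))

    S₁-count : ∀ T → T ≤ N → #H∩ a₁ a₂ S₁ 0 T ≡ xcoord T ⊓ q
    S₁-count T T≤N = trans (countFrom-cong 0 T λ t _ t<T → S₁-step t (<-≤-trans t<T T≤N))
                           (countFrom-first (isE a₁ a₂) q T)

    S₂-count : ∀ T → T ≤ N → #V∩ a₁ a₂ S₂ 0 T ≡ ycoord T ∸ (a₂ ∸ p)
    S₂-count T T≤N = trans (countFrom-cong 0 T λ t _ t<T → S₂-step t (<-≤-trans t<T T≤N))
                           (countFrom-after (isN a₁ a₂) (a₂ ∸ p) T)

module _ (a₁′ a₂ : ℕ) where
  open DyckPath a₁′ a₂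

  extremal-height : ∀ p q → 1 ≤ p → p ≤ a₂ → a₁ * p + a₂ * suc q < a₁ * a₂ + a₁ + a₂ → h q ≤ a₂ ∸ p
  extremal-height p q 1≤p p≤a₂ hyp = ≤-pred (Equivalence.from (height-<⇔ q (suc r) r<a₂) bound)
    where
      r = a₂ ∸ p
      a₂≡p+r : a₂ ≡ p + r
      a₂≡p+r = sym (m+[n∸m]≡n p≤a₂)
      r<a₂ : suc r ≤ a₂
      r<a₂ = subst (suc r ≤_) (sym a₂≡p+r) (+-monoˡ-≤ r 1≤p)
      bound : q * a₂ < suc r * a₁
      bound = subst (λ A → q * A < suc r * a₁) (sym a₂≡p+r)
        (extremal-bound a₁ p r q (subst (λ A → a₁ * p + A * suc q < a₁ * A + a₁ + A) a₂≡p+r hyp))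

  -- Step tu is u = u_{Q+1} and step tv is v = v_{a₂−P}; the top F of v has height y and v
  -- lies in the column x = K.
  module StepPair (p q b c : ℕ) (p≤a₂ : p ≤ a₂) (S₁-below-S₂ : h (q ∸ 1) ≤ a₂ ∸ p)
                  (Q P tu tv : ℕ) (Q<q : suc Q ≤ q) (P<p : suc P ≤ p) (tu<N : tu < N) (tv<N : tv < N)
                  (u-east : isE a₁ a₂ tu ≡ true) (u-index : hIdx a₁ a₂ tu ≡ suc Q)
                  (v-north : isN a₁ a₂ tv ≡ true) (v-index : vIdx a₁ a₂ tv ≡ a₂ ∸ suc P + 1) where

    open Extremal p q

    r y K L : ℕ
    r = a₂ ∸ p
    y = ycoord (suc tv)
    K = xcoord tv
    L = arcLen N tu (wrap N (suc tv))

    v-east : isE a₁ a₂ tv ≡ false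
    v-east = not-injective {y = false} v-north

    x-u : xcoord tu ≡ Q
    x-u = suc-injective (trans (sym (hIdx-east tu tu<N u-east)) u-index)

    y-u : ycoord tu ≡ h Q
    y-u = trans (east-on-height tu tu<N u-east) (cong h x-u)

    y≡1+y-v : y ≡ suc (ycoord tv)
    y≡1+y-v = countFrom-suc-true (isN a₁ a₂) 0 tv v-north

    x-v : xcoord (suc tv) ≡ K
    x-v = countFrom-suc-false (isE a₁ a₂) 0 tv v-east

    y+P≡a₂ : y + P ≡ a₂
    y+P≡a₂ = begin
      y + P                   ≡⟨ cong (_+ P) (trans y≡1+y-v (sym (vIdx-north tv tv<N v-north))) ⟩
      vIdx a₁ a₂ tv + P       ≡⟨ cong (_+ P) v-index ⟩
      a₂ ∸ suc P + 1 + P      ≡⟨ +-assoc (a₂ ∸ suc P) 1 P ⟩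
      a₂ ∸ suc P + suc P      ≡⟨ m∸n+n≡m (≤-trans P<p p≤a₂) ⟩
      a₂                      ∎
      where open ≡-Reasoning

    y≤a₂ : y ≤ a₂
    y≤a₂ = subst (y ≤_) y+P≡a₂ (m≤m+n y P)

    r<y : r < y
    r<y = +-cancelʳ-< P r y (begin-strict
      r + P   <⟨ +-monoʳ-< r P<p ⟩
      r + p   ≡⟨ m∸n+n≡m p≤a₂ ⟩
      a₂      ≡⟨ sym y+P≡a₂ ⟩
      y + P   ∎)
      where open ≤-Reasoning

    Q≤q-1 : Q ≤ q ∸ 1
    Q≤q-1 = ≤-trans (≤-reflexive (sym (m+n∸m≡n 1 Q))) (∸-monoˡ-≤ 1 Q<q)

    hQ≤r : h Q ≤ r
    hQ≤r = ≤-trans (height-mono Q≤q-1) S₁-below-S₂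

    u-before-v : tu ≤ tv
    u-before-v = ≮⇒≥ λ tv<tu → <⇒≱ r<y (begin
      y              ≤⟨ countFrom-monoʳ (isN a₁ a₂) 0 tv<tu ⟩
      ycoord tu      ≡⟨ y-u ⟩
      h Q            ≤⟨ hQ≤r ⟩
      r              ∎)
      where open ≤-Reasoning

    column-below : h (K ∸ 1) < y
    column-below = subst (h (K ∸ 1) <_) (sym y≡1+y-v) (s≤s (height-before-≤ tv (<⇒≤ tv<N)))

    column-above : y ≤ h K
    column-above = subst (_≤ h K) (sym y≡1+y-v) (north-below-height tv tv<N v-east)

    q≤K : q ≤ K
    q≤K = subst (_≤ K) (m+[n∸m]≡n (≤-trans (s≤s z≤n) Q<q))
      (Equivalence.from (column-< K y (q ∸ 1) column-below column-above) (≤-<-trans S₁-below-S₂ r<y))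

    on-arc : ∀ f → countFrom f tu L ≡ countFrom f 0 (suc tv) ∸ countFrom f 0 tu
    on-arc f = begin
        countFrom f tu L
      ≡⟨ cong (countFrom f tu) (arcLen-forward (a₁′ + a₂) tu tv u-before-v tv<N) ⟩
        countFrom f tu (suc (tv ∸ tu))
      ≡⟨ countFrom-window f tu (suc (tv ∸ tu)) ⟩
        countFrom f 0 (tu + suc (tv ∸ tu)) ∸ countFrom f 0 tu
      ≡⟨ cong (λ n → countFrom f 0 n ∸ countFrom f 0 tu) (trans (+-suc tu _) (cong suc (m+[n∸m]≡n u-before-v))) ⟩
        countFrom f 0 (suc tv) ∸ countFrom f 0 tu
      ∎
      where open ≡-Reasoning

    #H-arc : #H a₁ a₂ tu L ≡ K ∸ Q
    #H-arc = trans (on-arc (isE a₁ a₂)) (cong₂ _∸_ x-v x-u)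

    #V-arc : #V a₁ a₂ tu L ≡ y ∸ h Q
    #V-arc = trans (on-arc (isN a₁ a₂)) (cong (y ∸_) y-u)

    #V∩-arc : #V∩ a₁ a₂ S₂ tu L ≡ y ∸ r
    #V∩-arc = begin
      #V∩ a₁ a₂ S₂ tu L                                 ≡⟨ on-arc _ ⟩
      #V∩ a₁ a₂ S₂ 0 (suc tv) ∸ #V∩ a₁ a₂ S₂ 0 tu       ≡⟨ cong₂ _∸_ (S₂-count (suc tv) tv<N) (S₂-count tu (<⇒≤ tu<N)) ⟩
      (y ∸ r) ∸ (ycoord tu ∸ r)                         ≡⟨ cong (λ z → (y ∸ r) ∸ (z ∸ r)) y-u ⟩
      (y ∸ r) ∸ (h Q ∸ r)                               ≡⟨ cong ((y ∸ r) ∸_) (m≤n⇒m∸n≡0 hQ≤r) ⟩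
      y ∸ r                                             ∎
      where open ≡-Reasoning

    #H∩-arc : #H∩ a₁ a₂ S₁ tu L ≡ q ∸ Q
    #H∩-arc = begin
      #H∩ a₁ a₂ S₁ tu L                                 ≡⟨ on-arc _ ⟩
      #H∩ a₁ a₂ S₁ 0 (suc tv) ∸ #H∩ a₁ a₂ S₁ 0 tu       ≡⟨ cong₂ _∸_ (S₁-count (suc tv) tv<N) (S₁-count tu (<⇒≤ tu<N)) ⟩
      xcoord (suc tv) ⊓ q ∸ xcoord tu ⊓ q               ≡⟨ cong₂ (λ m n → m ⊓ q ∸ n ⊓ q) x-v x-u ⟩
      K ⊓ q ∸ Q ⊓ q                                     ≡⟨ cong₂ _∸_ (m≥n⇒m⊓n≡n q≤K) (m≤n⇒m⊓n≡m (≤-trans (n≤1+n Q) Q<q)) ⟩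
      q ∸ Q                                             ∎
      where open ≡-Reasoning

    p≡y∸r+P : p ≡ (y ∸ r) + P
    p≡y∸r+P = +-cancelˡ-≡ r p ((y ∸ r) + P) (begin
      r + p              ≡⟨ +-comm r p ⟩
      p + r              ≡⟨ m+[n∸m]≡n p≤a₂ ⟩
      a₂                 ≡⟨ sym y+P≡a₂ ⟩
      y + P              ≡⟨ cong (_+ P) (sym (m+[n∸m]≡n (<⇒≤ r<y))) ⟩
      r + (y ∸ r) + P    ≡⟨ +-assoc r (y ∸ r) P ⟩
      r + (y ∸ r + P)    ∎)
      where open ≡-Reasoning

    cond₁⇔ : Cond₁ a₁ a₂ b S₂ tu tv ⇔ Ineq₁ a₁ a₂ b p (suc P) (suc Q)
    cond₁⇔ = begin
      Cond₁ a₁ a₂ b S₂ tu tv                ≡⟨ cong₂ (λ m n → b * m < n) #V∩-arc #H-arc ⟩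
      b * (y ∸ r) < K ∸ Q                   ≈⟨ <∸⇔+< (b * (y ∸ r)) K Q ⟩
      b * (y ∸ r) + Q < K                   ≈⟨ column-< K y (b * (y ∸ r) + Q) column-below column-above ⟩
      h (b * (y ∸ r) + Q) < y               ≈⟨ height-<⇔ (b * (y ∸ r) + Q) y y≤a₂ ⟩
      (b * (y ∸ r) + Q) * a₂ < y * a₁       ≈⟨ ineq₁⇔ {a₁} {a₂} {b} {p} (y ∸ r) y P Q (sym y+P≡a₂) p≡y∸r+P ⟨
      Ineq₁ a₁ a₂ b p (suc P) (suc Q)       ∎
      where
        open ⇔-Reasoning

    cond₂⇔ : Cond₂ a₁ a₂ c S₁ tu tv ⇔ Ineq₂ a₁ a₂ c q (suc P) (suc Q)
    cond₂⇔ = begin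
      Cond₂ a₁ a₂ c S₁ tu tv                ≡⟨ cong₂ (λ m n → c * m < n) #H∩-arc #V-arc ⟩
      w < y ∸ h Q                           ≈⟨ <∸⇔+< w y (h Q) ⟩
      w + h Q < y                           ≡⟨ cong (_< y) (+-comm w (h Q)) ⟩
      h Q + w < y                           ≈⟨ <∸⇔+< (h Q) y w ⟨
      h Q < y ∸ w                           ≈⟨ height-<⇔ Q (y ∸ w) (≤-trans (m∸n≤m y w) y≤a₂) ⟩
      Q * a₂ < (y ∸ w) * a₁                 ≡⟨ cong (Q * a₂ <_) (*-distribʳ-∸ a₁ y w) ⟩
      Q * a₂ < y * a₁ ∸ w * a₁              ≈⟨ <∸⇔+< (Q * a₂) (y * a₁) (w * a₁) ⟩
      Q * a₂ + w * a₁ < y * a₁              ≈⟨ ineq₂⇔ {a₁} {a₂} {c} {q} (q ∸ Q) y P Q (sym y+P≡a₂) q≡ ⟨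
      Ineq₂ a₁ a₂ c q (suc P) (suc Q)       ∎
      where
        open ⇔-Reasoning
        w = c * (q ∸ Q)
        q≡ : q ≡ (q ∸ Q) + Q
        q≡ = sym (m∸n+n≡m (≤-trans (n≤1+n Q) Q<q))

  S₁-index : ∀ q tu → tu < N → isE a₁ a₂ tu ≡ true → extS₁ a₁ a₂ q tu ≡ true →
             ∃[ Q ] (suc Q ≤ q × hIdx a₁ a₂ tu ≡ suc Q)
  S₁-index q tu tu<N east inS₁ =
    xcoord tu , subst (_≤ q) (hIdx-east tu tu<N east) hIdx≤q , hIdx-east tu tu<N east
    where
      hIdx≤q : hIdx a₁ a₂ tu ≤ q
      hIdx≤q = ≤ᵇ-sound (trans (cong (_∧ (hIdx a₁ a₂ tu ≤ᵇ q)) (sym east)) inS₁)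

  S₂-index : ∀ p tv → p ≤ a₂ → tv < N → isN a₁ a₂ tv ≡ true → extS₂ a₁ a₂ p tv ≡ true →
             ∃[ P ] (suc P ≤ p × vIdx a₁ a₂ tv ≡ a₂ ∸ suc P + 1)
  S₂-index p tv p≤a₂ tv<N north inS₂ = a₂ ∸ suc y , P<p , index
    where
      y = ycoord tv
      y<a₂ : y < a₂
      y<a₂ = <-≤-trans (north-below-height tv tv<N (not-injective {y = false} north)) (height-≤ (xcoord tv))
      r<v : a₂ ∸ p < vIdx a₁ a₂ tv
      r<v = <ᵇ⇒< (a₂ ∸ p) _ (Equivalence.from T-≡ (trans (cong (_∧ (a₂ ∸ p <ᵇ vIdx a₁ a₂ tv)) (sym north)) inS₂))
      1+P≡a₂∸y : suc (a₂ ∸ suc y) ≡ a₂ ∸ y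
      1+P≡a₂∸y = sym (+-∸-assoc 1 y<a₂)
      P<p : suc (a₂ ∸ suc y) ≤ p
      P<p = begin
        suc (a₂ ∸ suc y)   ≡⟨ 1+P≡a₂∸y ⟩
        a₂ ∸ y             ≤⟨ ∸-monoʳ-≤ a₂ (≤-pred (subst (a₂ ∸ p <_) (vIdx-north tv tv<N north) r<v)) ⟩
        a₂ ∸ (a₂ ∸ p)      ≡⟨ m∸[m∸n]≡n p≤a₂ ⟩
        p                  ∎
        where open ≤-Reasoning
      index : vIdx a₁ a₂ tv ≡ a₂ ∸ suc (a₂ ∸ suc y) + 1
      index = begin
        vIdx a₁ a₂ tv                ≡⟨ vIdx-north tv tv<N north ⟩
        suc y                        ≡⟨ +-comm 1 y ⟩
        y + 1                        ≡⟨ cong (_+ 1) (sym (m∸[m∸n]≡n (<⇒≤ y<a₂))) ⟩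
        a₂ ∸ (a₂ ∸ y) + 1            ≡⟨ cong (λ n → a₂ ∸ n + 1) (sym 1+P≡a₂∸y) ⟩
        a₂ ∸ suc (a₂ ∸ suc y) + 1    ∎
        where open ≡-Reasoning

  extremal-conditions⇔ : ∀ p q b c → p ≤ a₂ → h (q ∸ 1) ≤ a₂ ∸ p →
    ∀ q′ p′ → 1 ≤ q′ → q′ ≤ q → 1 ≤ p′ → p′ ≤ p →
    ∀ tu tv → tu < N → tv < N →
    isE a₁ a₂ tu ≡ true → hIdx a₁ a₂ tu ≡ q′ →
    isN a₁ a₂ tv ≡ true → vIdx a₁ a₂ tv ≡ a₂ ∸ p′ + 1 →
    (Cond₁ a₁ a₂ b (extS₂ a₁ a₂ p) tu tv ⇔ Ineq₁ a₁ a₂ b p p′ q′)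
    × (Cond₂ a₁ a₂ c (extS₁ a₁ a₂ q) tu tv ⇔ Ineq₂ a₁ a₂ c q p′ q′)
  extremal-conditions⇔ p q b c p≤a₂ S₁-below-S₂ (suc Q) (suc P) _ Q<q _ P<p tu tv tu<N tv<N east u-index north v-index =
    cond₁⇔ , cond₂⇔
    where open StepPair p q b c p≤a₂ S₁-below-S₂ Q P tu tv Q<q P<p tu<N tv<N east u-index north v-index

  extremal-compatible : ∀ p q b c → 1 ≤ b → 1 ≤ c → p ≤ a₂ → h (q ∸ 1) ≤ a₂ ∸ p →
    (∀ p′ q′ → 1 ≤ p′ → p′ ≤ p → 1 ≤ q′ → q′ ≤ q → Ineq₁ a₁ a₂ b p p′ q′ ⊎ Ineq₂ a₁ a₂ c q p′ q′) →
    Compatible a₁ a₂ b c (extS₁ a₁ a₂ q) (extS₂ a₁ a₂ p)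
  extremal-compatible p q b c 1≤b 1≤c p≤a₂ S₁-below-S₂ ineq =
    compatible-if-strict a₁′ a₂ b c _ _ 1≤b 1≤c (Extremal.S₂-wrapInvariant p q)
      λ tu tv tu<N tv<N east inS₁ north inS₂ →
        let Q , Q<q , u-index = S₁-index q tu tu<N east inS₁
            P , P<p , v-index = S₂-index p tv p≤a₂ tv<N north inS₂
            cond₁⇔ , cond₂⇔ = extremal-conditions⇔ p q b c p≤a₂ S₁-below-S₂ (suc Q) (suc P) (s≤s z≤n) Q<q (s≤s z≤n) P<p
                                tu tv tu<N tv<N east u-index north v-index
        in Sum.map (Equivalence.from cond₁⇔) (Equivalence.from cond₂⇔) (ineq (suc P) (suc Q) (s≤s z≤n) P<p (s≤s z≤n) Q<q)

lemma3p6 : (b c a₁ a₂ p q : ℕ) →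
    1 ≤ b → 1 ≤ c → 1 ≤ a₁ → 1 ≤ a₂ →
    c * a₁ * a₁ + b * a₂ * a₂ ≤ b * c * a₁ * a₂ →
    1 ≤ p → 1 ≤ q → q ≤ a₁ → p ≤ a₂ →
    a₁ * p + a₂ * q < a₁ * a₂ + a₁ + a₂ →
    ((∀ tu tv → tu < len a₁ a₂ → tv < len a₁ a₂ →
        isE a₁ a₂ tu ≡ true → extS₁ a₁ a₂ q tu ≡ true →
        isN a₁ a₂ tv ≡ true → extS₂ a₁ a₂ p tv ≡ true →
        Cond₁ a₁ a₂ b (extS₂ a₁ a₂ p) tu tv ⊎ Cond₂ a₁ a₂ c (extS₁ a₁ a₂ q) tu tv)
      → Compatible a₁ a₂ b c (extS₁ a₁ a₂ q) (extS₂ a₁ a₂ p))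
    × (∀ q' p' → 1 ≤ q' → q' ≤ q → 1 ≤ p' → p' ≤ p →
        ∀ tu tv → tu < len a₁ a₂ → tv < len a₁ a₂ →
        isE a₁ a₂ tu ≡ true → hIdx a₁ a₂ tu ≡ q' →
        isN a₁ a₂ tv ≡ true → vIdx a₁ a₂ tv ≡ a₂ ∸ p' + 1 →
        (Cond₁ a₁ a₂ b (extS₂ a₁ a₂ p) tu tv ⇔ Ineq₁ a₁ a₂ b p p' q')
        × (Cond₂ a₁ a₂ c (extS₁ a₁ a₂ q) tu tv ⇔ Ineq₂ a₁ a₂ c q p' q'))
    × ((∀ p' q' → 1 ≤ p' → p' ≤ p → 1 ≤ q' → q' ≤ q →
          Ineq₁ a₁ a₂ b p p' q' ⊎ Ineq₂ a₁ a₂ c q p' q')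
      → Compatible a₁ a₂ b c (extS₁ a₁ a₂ q) (extS₂ a₁ a₂ p))
lemma3p6 b c zero      a₂ p q       _   _   ()
lemma3p6 b c (suc a₁′) a₂ p zero    _   _   _ _ _ _   ()
lemma3p6 b c (suc a₁′) a₂ p (suc q) 1≤b 1≤c _ _ _ 1≤p _ _ p≤a₂ hyp =
    compatible-if-strict a₁′ a₂ b c _ _ 1≤b 1≤c (DyckPath.Extremal.S₂-wrapInvariant a₁′ a₂ p (suc q))
  , extremal-conditions⇔ a₁′ a₂ p (suc q) b c p≤a₂ S₁-below-S₂
  , extremal-compatible a₁′ a₂ p (suc q) b c 1≤b 1≤c p≤a₂ S₁-below-S₂
  where
    S₁-below-S₂ : height (suc a₁′) a₂ q ≤ a₂ ∸ p
    S₁-below-S₂ = extremal-height a₁′ a₂ p q 1≤p p≤a₂ hyp
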